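{- Let $G$ be a finite abelian group. Then every power automorphism of $G$ is perfect-code-preserving and total-perfect-code-preserving. In particular, for any positive integer $m$ coprime to $|G|$, the automorphism $g\mapsto g^m$ of $G$ is perfect-code-preserving and total-perfect-code-preserving.
   Context: All groups and graphs are finite; $e$ denotes the identity. For $S\subseteq G$ with $e\notin S$ and $S^{ -1}=S$, the Cayley graph $\mathrm{Cay}(G,S)$ has vertex set $G$, with $x,y$ adjacent iff $yx^{ -1}\in S$. A subset $C$ of the vertex set of a graph is a perfect code if every vertex is at distance at most one from exactly one vertex of $C$; it is a total perfect code if every vertex has exactly one neighbour in $C$. An automorphism $\sigma$ of $G$ is perfect-code-preserving if for every Cayley graph $\mathrm{Cay}(G,S)$ and every subset $C\subseteq G$ that is a perfect code in $\mathrm{Cay}(G,S)$, the image $C^\sigma$ is also a perfect code in $\mathrm{Cay}(G,S)$; total-perfect-code-preserving is defined analogously with total perfect codes. A power automorphism of $G$ is an automorphism mapping every element $g$ to some power of $g$. -}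

module Defs where

open import Level using (0ℓ)
open import Data.Nat using (ℕ; zero; suc)
open import Data.Fin using (Fin)
open import Data.Product using (_×_; Σ; ∃; ∃-syntax; _,_)
open import Data.Sum using (_⊎_)
open import Relation.Nullary using (¬_)
open import Relation.Unary using (Pred)
open import Relation.Binary.PropositionalEquality using (_≡_)
open import Algebra.Structures using (IsAbelianGroup)
open import Function.Definitions using (Bijective)

-- A finite abelian group of order n, presented with carrier Fin n
-- (every finite abelian group is isomorphic to one of these) and
-- propositional equality as the group equality.
record FinAbGroup (n : ℕ) : Set where
  infixl 7 _∙_
  field
    _∙_ : Fin n → Fin n → Fin n
    ε   : Fin n
    _⁻¹ : Fin n → Fin n
    isAbelianGroup : IsAbelianGroup _≡_ _∙_ ε _⁻¹

  _^_ : Fin n → ℕ → Fin n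
  g ^ zero    = ε
  g ^ (suc k) = g ∙ (g ^ k)

  Subset : Set₁
  Subset = Pred (Fin n) 0ℓ

  IsConnectionSet : Subset → Set
  IsConnectionSet S = ¬ S ε × (∀ s → S s → S (s ⁻¹))

  Adj : Subset → Fin n → Fin n → Set
  Adj S x y = S (y ∙ (x ⁻¹))

  ExactlyOne : (Fin n → Set) → Set
  ExactlyOne P = Σ (Fin n) λ c → P c × (∀ d → P d → d ≡ c)

  IsPerfectCode : Subset → Subset → Set
  IsPerfectCode S C = ∀ x → ExactlyOne (λ c → C c × (c ≡ x ⊎ Adj S x c))

  IsTotalPerfectCode : Subset → Subset → Set
  IsTotalPerfectCode S C = ∀ x → ExactlyOne (λ c → C c × Adj S x c)

  Image : (Fin n → Fin n) → Subset → Subset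
  Image σ C y = ∃[ c ] (C c × σ c ≡ y)

  IsAutomorphism : (Fin n → Fin n) → Set
  IsAutomorphism σ = (∀ x y → σ (x ∙ y) ≡ σ x ∙ σ y) × Bijective _≡_ _≡_ σ

  IsPowerAutomorphism : (Fin n → Fin n) → Set
  IsPowerAutomorphism σ = IsAutomorphism σ × (∀ g → ∃[ k ] (σ g ≡ g ^ k))

  PerfectCodePreserving : (Fin n → Fin n) → Set₁
  PerfectCodePreserving σ =
    ∀ (S : Subset) → IsConnectionSet S →
    ∀ (C : Subset) → IsPerfectCode S C → IsPerfectCode S (Image σ C)

  TotalPerfectCodePreserving : (Fin n → Fin n) → Set₁
  TotalPerfectCodePreserving σ =
    ∀ (S : Subset) → IsConnectionSet S →
    ∀ (C : Subset) → IsTotalPerfectCode S C → IsTotalPerfectCode S (Image σ C)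

-- A power automorphism σ of a finite abelian group G is a universal power map: taking g of
-- maximal order, every x splits as y ∙ g ^ q with ⟨y⟩ ∩ ⟨g⟩ trivial, which forces σ x ≡ x ^ K
-- for one exponent K.  As σ is injective, so is x ↦ x ^ p for every prime p ∣ K, and it
-- therefore suffices that x ↦ x ^ p preserves codes for such p.
--
-- Both kinds of codes are codes for a neighbourhood B (S, resp. S ∪ {ε}): every x is c ∙ b⁻¹
-- for exactly one c ∈ C, b ∈ B.  In the group semiring ℕ[G] this reads 1_C ⋆ B̃ = Ĝ, with
-- B̃ = 1_{B⁻¹} and Ĝ the sum of all elements.  By the freshman's dream 1_C ^ p ≡ 1_{C^(p)}
-- (mod p), so 1_{C^(p)} ⋆ B̃ ≡ 1_C ^ (p ∸ 1) ⋆ Ĝ = |C| ^ (p ∸ 1) Ĝ (mod p).  If p ∤ |G| then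
-- p ∤ |C|, so no coefficient of 1_{C^(p)} ⋆ B̃ vanishes; they sum to |C| |B| = |G|, hence all
-- are 1.  Finally p ∤ |G| follows from the injectivity of x ↦ x ^ p by the same congruence
-- applied to Ĝ ^ p at ε.

module Submission where

open import Defs
open import Data.Nat using (ℕ; _<_)
open import Data.Nat.Coprimality using (Coprime)
open import Data.Product using (_×_; _,_)
open import Algebra.Bundles using (CommutativeSemiring)

module Arithmetic where

  open import Data.Empty using (⊥-elim)
  open import Data.Nat as ℕ using (zero; suc; _∸_; _!; NonZero; s≤s)
  open import Data.Nat.Properties using (<⇒≤; <⇒≱; <-trans; n<1+n; ∸-monoʳ-<; _!*_!≢0)
  open import Data.Nat.Divisibility using (_∣_; ∣⇒≤; ∣1⇒≡1; m∣m*n)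
  open import Data.Nat.DivMod using (m/n*n≡m)
  open import Data.Nat.Combinatorics using (_C_; k![n∸k]!∣n!)
  open import Data.Nat.Combinatorics.Specification using (nCk≡n!/k![n-k]!)
  open import Data.Nat.Primality using (Prime; euclidsLemma; prime⇒nonTrivial; prime⇒nonZero)
  open import Data.Product using (Σ)
  open import Data.Sum using (inj₁; inj₂)
  open import Function using (_∘_)
  open import Relation.Nullary using (Dec; yes; no; ¬_)
  open import Relation.Binary.PropositionalEquality using (_≡_; cong; subst; sym; trans)

  n∣n! : ∀ n → .{{NonZero n}} → n ∣ n !
  n∣n! (suc n) = m∣m*n (n !)

  prime∤! : ∀ {p} → Prime p → ∀ j → j < p → ¬ p ∣ j !
  prime∤! pp zero _ p∣1 = ℕ.nonTrivial⇒≢1 {{prime⇒nonTrivial pp}} (∣1⇒≡1 p∣1)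
  prime∤! pp (suc j) j<p p∣j! with euclidsLemma (suc j) (j !) pp p∣j!
  ... | inj₁ p∣1+j = <⇒≱ j<p (∣⇒≤ p∣1+j)
  ... | inj₂ p∣j!  = prime∤! pp j (<-trans (n<1+n j) j<p) p∣j!

  prime∣binomial : ∀ {p k} → Prime p → 0 < k → k < p → p ∣ p C k
  prime∣binomial {p} {k} pp 0<k k<p with euclidsLemma (p C k) (k ! ℕ.* (p ∸ k) !) pp p∣p!
    where
    instance _ = k !* (p ∸ k) !≢0
    p∣p! : p ∣ (p C k) ℕ.* (k ! ℕ.* (p ∸ k) !)
    p∣p! = subst (p ∣_)
      (sym (trans (cong (ℕ._* (k ! ℕ.* (p ∸ k) !)) (nCk≡n!/k![n-k]! (<⇒≤ k<p))) (m/n*n≡m (k![n∸k]!∣n! (<⇒≤ k<p)))))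
      (n∣n! p {{prime⇒nonZero pp}})
  ... | inj₁ p∣pCk = p∣pCk
  ... | inj₂ p∣k![p∸k]! with euclidsLemma (k !) ((p ∸ k) !) pp p∣k![p∸k]!
  ...   | inj₁ p∣k!     = ⊥-elim (prime∤! pp k k<p p∣k!)
  ...   | inj₂ p∣[p∸k]! = ⊥-elim (prime∤! pp (p ∸ k) (∸-monoʳ-< 0<k (<⇒≤ k<p)) p∣[p∸k]!)
  prime∣^⇒prime∣ : ∀ {p} → Prime p → ∀ m k → p ∣ m ℕ.^ k → p ∣ m
  prime∣^⇒prime∣ pp m zero    p∣1   = ⊥-elim (ℕ.nonTrivial⇒≢1 {{prime⇒nonTrivial pp}} (∣1⇒≡1 p∣1))
  prime∣^⇒prime∣ pp m (suc k) p∣m^k with euclidsLemma m (m ℕ.^ k) pp p∣m^k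
  ... | inj₁ p∣m   = p∣m
  ... | inj₂ p∣m^k = prime∣^⇒prime∣ pp m k p∣m^k

  least-witness : ∀ {P : ℕ → Set} → (∀ k → Dec (P k)) → ∀ w → P w → Σ ℕ λ m → P m × (∀ k → k < m → ¬ P k)
  least-witness P? zero    Pw = zero , Pw , λ _ ()
  least-witness P? (suc w) Pw with P? zero
  ... | yes P₀ = zero , P₀ , λ _ ()
  ... | no ¬P₀ with least-witness (P? ∘ suc) w Pw
  ...   | m , Pm , below = suc m , Pm , λ { zero _ → ¬P₀ ; (suc k) (s≤s k<m) → below k k<m }

module FreshmansDream {c ℓ} (S : CommutativeSemiring c ℓ) where

  open import Data.Nat as ℕ using (zero; suc; _∸_; z≤n; s≤s)
  open import Data.Nat.Properties using (n∸n≡0)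
  import Data.Nat.Properties as ℕₚ
  open import Data.Nat.Combinatorics using (_C_; nCn≡1; nCk≡nC[n∸k])
  open import Data.Nat.Divisibility using (_∣_)
  open import Data.Nat.Primality using (Prime)
  open import Data.Fin using (Fin; zero; suc; toℕ; fromℕ; inject₁)
  open import Data.Fin.Properties using (toℕ-fromℕ; toℕ-inject₁; toℕ<n)
  open import Data.Product using (∃-syntax)
  open import Relation.Binary.PropositionalEquality as ≡ using (_≡_; cong; cong₂)
  open Arithmetic using (prime∣binomial)

  open CommutativeSemiring S hiding (zero)
  open import Algebra.Properties.Semiring.Exp semiring using (_^_)
  open import Algebra.Properties.Semiring.Mult semiring using (×-homo-1; ×-assocˡ) renaming (_×_ to _·_)
  open import Algebra.Properties.CommutativeMonoid.Mult +-commutativeMonoid using (×-distrib-+)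
  open import Algebra.Properties.CommutativeSemigroup +-commutativeSemigroup using (x∙yz≈zx∙y)
  open import Algebra.Properties.CommutativeSemiring.Binomial S using (theorem; binomial; binomialTerm)
  open import Algebra.Properties.Monoid.Sum +-monoid using (sum; sum-init-last; sum-cong-≋)
  open import Relation.Binary.Reasoning.Setoid setoid

  ·-zeroʳ : ∀ m → m · 0# ≈ 0#
  ·-zeroʳ zero    = refl
  ·-zeroʳ (suc m) = trans (+-identityˡ _) (·-zeroʳ m)

  sum-· : ∀ {k} m (f : Fin k → Carrier) → sum (λ i → m · f i) ≈ m · sum f
  sum-· {zero}  m f = sym (·-zeroʳ m)
  sum-· {suc k} m f = begin
    m · f zero + sum (λ i → m · f (suc i)) ≈⟨ +-congˡ (sum-· m (λ i → f (suc i))) ⟩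
    m · f zero + m · sum (λ i → f (suc i)) ≈⟨ ×-distrib-+ _ _ m ⟨
    m · sum f                              ∎

  ^-+-prime : ∀ {p} → Prime p → ∀ x y → ∃[ h ] (x + y) ^ p ≈ x ^ p + y ^ p + p · h
  ^-+-prime {p@(suc q)} pp x y = h , (begin
    (x + y) ^ p                                              ≈⟨ theorem p x y ⟩
    t zero + sum (λ j → t (suc j))                           ≈⟨ +-congˡ (sum-init-last (λ j → t (suc j))) ⟩
    t zero + (sum (λ j → t (suc (inject₁ j))) + t (suc (fromℕ q)))
                                   ≈⟨ +-cong first (+-cong middle last) ⟩
    y ^ p + (p · h + x ^ p)                                  ≈⟨ x∙yz≈zx∙y _ _ _ ⟩
    x ^ p + y ^ p + p · h                                    ∎)
    where
    t : Fin (suc p) → Carrier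
    t = binomialTerm x y p
    open _∣_ using (quotient; equality)
    first : t zero ≈ y ^ p
    first = begin
      (p C 0) · (1# * y ^ p)  ≡⟨ cong (_· (1# * y ^ p)) (≡.trans (nCk≡nC[n∸k] {0} {p} z≤n) (nCn≡1 p)) ⟩
      1 · (1# * y ^ p)        ≈⟨ ×-homo-1 _ ⟩
      1# * y ^ p              ≈⟨ *-identityˡ _ ⟩
      y ^ p                   ∎
    last : t (suc (fromℕ q)) ≈ x ^ p
    last = begin
      t (suc (fromℕ q))         ≡⟨ cong (λ m → (p C m) · (x ^ m * y ^ (p ∸ m))) (cong suc (toℕ-fromℕ q)) ⟩
      (p C p) · (x ^ p * y ^ (p ∸ p))  ≡⟨ cong₂ (λ c e → c · (x ^ p * y ^ e)) (nCn≡1 p) (n∸n≡0 p) ⟩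
      1 · (x ^ p * 1#)           ≈⟨ ×-homo-1 _ ⟩
      x ^ p * 1#                 ≈⟨ *-identityʳ _ ⟩
      x ^ p                      ∎
    p∣coefficient : ∀ (j : Fin q) → p ∣ p C suc (toℕ j)
    p∣coefficient j = prime∣binomial pp (s≤s z≤n) (s≤s (toℕ<n j))
    b : Fin q → Carrier
    b j = binomial x y p (suc (inject₁ j))
    h : Carrier
    h = sum (λ j → quotient (p∣coefficient j) · b j)
    middle : sum (λ j → t (suc (inject₁ j))) ≈ p · h
    middle = trans (sum-cong-≋ (λ j → begin
      t (suc (inject₁ j))                   ≡⟨ cong (λ m → (p C suc m) · b j) (toℕ-inject₁ j) ⟩
      (p C suc (toℕ j)) · b j               ≡⟨ cong (_· b j) (≡.trans (equality (p∣coefficient j))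
                                                                   (ℕₚ.*-comm (quotient (p∣coefficient j)) p)) ⟩
      (p ℕ.* quotient (p∣coefficient j)) · b j ≈⟨ ×-assocˡ (b j) p (quotient (p∣coefficient j)) ⟨
      p · (quotient (p∣coefficient j) · b j)   ∎)) (sum-· {q} p (λ j → quotient (p∣coefficient j) · b j))

  ^-sum-prime : ∀ {p} → Prime p → ∀ {k} (xs : Fin k → Carrier) →
                ∃[ h ] sum xs ^ p ≈ sum (λ i → xs i ^ p) + p · h
  ^-sum-prime {p@(suc q)} pp {zero} xs = 0# , (begin
    0# * 0# ^ q      ≈⟨ zeroˡ _ ⟩
    0#               ≈⟨ +-identityʳ 0# ⟨
    0# + 0#          ≈⟨ +-congˡ (·-zeroʳ p) ⟨
    0# + p · 0#      ∎)
  ^-sum-prime {p} pp {suc k} xs with ^-+-prime pp (xs zero) (sum (λ i → xs (suc i)))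
                                   | ^-sum-prime pp (λ i → xs (suc i))
  ... | h₁ , eq₁ | h₂ , eq₂ = h₂ + h₁ , (begin
    sum xs ^ p                                          ≈⟨ eq₁ ⟩
    x ^ p + s ^ p + p · h₁                              ≈⟨ +-congʳ (+-congˡ eq₂) ⟩
    x ^ p + (s′ + p · h₂) + p · h₁                      ≈⟨ +-congʳ (+-assoc _ _ _) ⟨
    x ^ p + s′ + p · h₂ + p · h₁                        ≈⟨ +-assoc _ _ _ ⟩
    x ^ p + s′ + (p · h₂ + p · h₁)                      ≈⟨ +-congˡ (×-distrib-+ h₂ h₁ p) ⟨
    x ^ p + s′ + p · (h₂ + h₁)                          ∎)
    where
    x = xs zero
    s = sum (λ i → xs (suc i))
    s′ = sum (λ i → xs (suc i) ^ p)

module Counting where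

  import Data.Nat.Properties as ℕₚ
  open import Algebra.Properties.CommutativeMonoid.Sum ℕₚ.+-0-commutativeMonoid
    using (sum; sum-cong-≗; sum-remove; sum-replicate-zero; ∑-distrib-+; ∑-comm; sum-permute)
  open import Algebra.Properties.Semiring.Sum ℕₚ.+-*-semiring using (*-distribˡ-sum; *-distribʳ-sum)
  open import Data.Empty using (⊥-elim)
  open import Data.Fin using (Fin; zero; suc; punchIn)
  open import Data.Fin.Permutation using (Permutation; _⟨$⟩ʳ_)
  open import Data.Fin.Properties using (punchInᵢ≢i; _≟_)
  open import Data.Nat as ℕ using (zero; suc; _+_; _*_; _∸_; _≤_)
  open import Data.Product using (Σ; _,_)
  open import Function using (_∘_)
  open import Relation.Nullary using (Dec; yes; no; ¬_)
  open import Relation.Nullary.Decidable using (_×-dec_)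
  open import Relation.Binary.PropositionalEquality

  -- Library sum lemmas restated for ∑, so that summands are inferred by unification.
  ∑ : ∀ {m} → (Fin m → ℕ) → ℕ
  ∑ = sum

  ∑-cong : ∀ {m} {f g : Fin m → ℕ} → (∀ i → f i ≡ g i) → ∑ f ≡ ∑ g
  ∑-cong = sum-cong-≗

  ∑-+ : ∀ {m} (f g : Fin m → ℕ) → ∑ (λ i → f i + g i) ≡ ∑ f + ∑ g
  ∑-+ = ∑-distrib-+

  ∑-*ˡ : ∀ {m} c (f : Fin m → ℕ) → ∑ (λ i → c * f i) ≡ c * ∑ f
  ∑-*ˡ c f = sym (*-distribˡ-sum c f)

  ∑-*ʳ : ∀ {m} c (f : Fin m → ℕ) → ∑ (λ i → f i * c) ≡ ∑ f * c
  ∑-*ʳ c f = sym (*-distribʳ-sum c f)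

  ∑-swap : ∀ {m k} (f : Fin m → Fin k → ℕ) → ∑ (λ i → ∑ (λ j → f i j)) ≡ ∑ (λ j → ∑ (λ i → f i j))
  ∑-swap = ∑-comm

  ∑-permute : ∀ {m} (f : Fin m → ℕ) (π : Permutation m m) → ∑ f ≡ ∑ (λ i → f (π ⟨$⟩ʳ i))
  ∑-permute = sum-permute

  ∑-0 : ∀ m → ∑ {m} (λ _ → 0) ≡ 0
  ∑-0 = sum-replicate-zero

  indicator : ∀ {p} {P : Set p} → Dec P → ℕ
  indicator (yes _) = 1
  indicator (no _)  = 0

  indicator-yes : ∀ {p} {P : Set p} (P? : Dec P) → P → indicator P? ≡ 1
  indicator-yes (yes _) _ = refl
  indicator-yes (no ¬p) p = ⊥-elim (¬p p)

  indicator-no : ∀ {p} {P : Set p} (P? : Dec P) → ¬ P → indicator P? ≡ 0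
  indicator-no (yes p) ¬p = ⊥-elim (¬p p)
  indicator-no (no _)  _  = refl

  indicator-× : ∀ {p q} {P : Set p} {Q : Set q} (P? : Dec P) (Q? : Dec Q) →
                indicator P? * indicator Q? ≡ indicator (P? ×-dec Q?)
  indicator-× (yes _) (yes _) = refl
  indicator-× (yes _) (no _)  = refl
  indicator-× (no _)  _       = refl

  indicator-cong : ∀ {p q} {P : Set p} {Q : Set q} (P? : Dec P) (Q? : Dec Q) →
                   (P → Q) → (Q → P) → indicator P? ≡ indicator Q?
  indicator-cong (yes _) (yes _) _ _ = refl
  indicator-cong (yes p) (no ¬q) f _ = ⊥-elim (¬q (f p))
  indicator-cong (no ¬p) (yes q) _ g = ⊥-elim (¬p (g q))
  indicator-cong (no _)  (no _)  _ _ = refl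

  ∑-1 : ∀ m → ∑ {m} (λ _ → 1) ≡ m
  ∑-1 zero    = refl
  ∑-1 (suc m) = cong suc (∑-1 m)

  ∑≡0⇒≡0 : ∀ {m} (f : Fin m → ℕ) → ∑ f ≡ 0 → ∀ i → f i ≡ 0
  ∑≡0⇒≡0 f eq zero    = ℕₚ.m+n≡0⇒m≡0 (f zero) eq
  ∑≡0⇒≡0 f eq (suc i) = ∑≡0⇒≡0 (f ∘ suc) (ℕₚ.m+n≡0⇒n≡0 (f zero) eq) i

  ∑-single : ∀ {m} (f : Fin m → ℕ) (j : Fin m) → (∀ i → i ≢ j → f i ≡ 0) → ∑ f ≡ f j
  ∑-single {suc m} f j others = begin
    ∑ f                                  ≡⟨ sum-remove {i = j} f ⟩
    f j + ∑ (λ k → f (punchIn j k))      ≡⟨ cong (f j +_) (∑-cong (λ k → others _ (punchInᵢ≢i j k))) ⟩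
    f j + ∑ {m} (λ _ → 0)                ≡⟨ cong (f j +_) (∑-0 m) ⟩
    f j + 0                                ≡⟨ ℕₚ.+-identityʳ (f j) ⟩
    f j                                    ∎
    where open ≡-Reasoning

  all≥1∧∑≡length⇒≡1 : ∀ {m} (f : Fin m → ℕ) → (∀ i → 1 ≤ f i) → ∑ f ≡ m → ∀ i → f i ≡ 1
  all≥1∧∑≡length⇒≡1 {m} f f≥1 ∑≡m i = begin
    f i               ≡⟨ ℕₚ.m+[n∸m]≡n (f≥1 i) ⟨
    1 + (f i ∸ 1)     ≡⟨ cong (1 +_) (∑≡0⇒≡0 excess ∑-excess≡0 i) ⟩
    1                 ∎
    where
    open ≡-Reasoning
    excess : Fin m → ℕ
    excess k = f k ∸ 1
    ∑-excess≡0 : ∑ excess ≡ 0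
    ∑-excess≡0 = ℕₚ.+-cancelˡ-≡ m (∑ excess) 0 (begin
      m + ∑ excess                    ≡⟨ cong (_+ ∑ excess) (∑-1 m) ⟨
      ∑ {m} (λ _ → 1) + ∑ excess    ≡⟨ ∑-+ (λ _ → 1) excess ⟨
      ∑ (λ k → 1 + excess k)          ≡⟨ ∑-cong (λ k → ℕₚ.m+[n∸m]≡n (f≥1 k)) ⟩
      ∑ f                             ≡⟨ ∑≡m ⟩
      m                                 ≡⟨ ℕₚ.+-identityʳ m ⟨
      m + 0                             ∎)

  module _ {m} {P : Fin m → Set} (P? : ∀ i → Dec (P i)) where

    count : ℕ
    count = ∑ (λ i → indicator (P? i))

    exactlyOne⇒count≡1 : Σ (Fin m) (λ c → P c × (∀ d → P d → d ≡ c)) → count ≡ 1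
    exactlyOne⇒count≡1 (c , Pc , unique) = trans
      (∑-single (λ i → indicator (P? i)) c (λ i i≢c → indicator-no (P? i) (i≢c ∘ unique i)))
      (indicator-yes (P? c) Pc)

  count≡1⇒exactlyOne : ∀ {m} {P : Fin m → Set} (P? : ∀ i → Dec (P i)) →
                       count P? ≡ 1 → Σ (Fin m) (λ c → P c × (∀ d → P d → d ≡ c))
  count≡1⇒exactlyOne {suc m} {P} P? = split (P? zero)
    where
    rest = count (P? ∘ suc)
    split : (P₀? : Dec (P zero)) → indicator P₀? + rest ≡ 1 → Σ (Fin (suc m)) (λ c → P c × (∀ d → P d → d ≡ c))
    split (yes P₀) eq = zero , P₀ , λ
      { zero    _    → refl
      ; (suc d) P[d] → ⊥-elim (ℕₚ.1+n≢0 (trans (sym (indicator-yes (P? (suc d)) P[d]))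
                                             (∑≡0⇒≡0 _ (ℕₚ.suc-injective eq) d)))
      }
    split (no ¬P₀) eq with count≡1⇒exactlyOne (P? ∘ suc) eq
    ... | c , P[c] , unique = suc c , P[c] , λ
      { zero    P₀   → ⊥-elim (¬P₀ P₀)
      ; (suc d) P[d] → cong suc (unique d P[d])
      }

  ∑-δ : ∀ {m} (j : Fin m) (f : Fin m → ℕ) → ∑ (λ i → indicator (i ≟ j) * f i) ≡ f j
  ∑-δ j f = begin
    ∑ (λ i → indicator (i ≟ j) * f i)    ≡⟨ ∑-single (λ i → indicator (i ≟ j) * f i) j
                                                (λ i i≢j → cong (_* f i) (indicator-no (i ≟ j) i≢j)) ⟩
    indicator (j ≟ j) * f j              ≡⟨ cong (_* f j) (indicator-yes (j ≟ j) refl) ⟩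
    1 * f j                              ≡⟨ ℕₚ.*-identityˡ (f j) ⟩
    f j                                  ∎
    where open ≡-Reasoning

module FinAbGroupProperties {n : ℕ} (G : FinAbGroup n) where

  open import Level using (0ℓ)
  open import Algebra.Bundles using (AbelianGroup)
  import Algebra.Properties.AbelianGroup as AbelianGroupProperties
  import Algebra.Properties.CommutativeMonoid.Sum as CommutativeMonoidSum
  import Algebra.Properties.CommutativeSemigroup as CommutativeSemigroupProperties
  open import Data.Fin as Fin using (Fin)
  open import Data.Fin.Permutation using (permutation)
  open import Data.Fin.Properties using (nonZeroIndex)
  open import Data.Nat as ℕ using (zero; suc; _+_; _*_; pred)
  import Data.Nat.Properties as ℕₚ
  open import Data.Nat.Coprimality using (coprime-Bézout)
  open import Data.Nat.Divisibility using (_∣_; divides)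
  open import Data.Nat.GCD using (module Bézout)
  open import Data.Product using (Σ)
  open import Function using (_∘_)
  open import Function.Consequences.Propositional
    using (inverseᵇ⇒bijective; strictlyInverseˡ⇒inverseˡ; strictlyInverseʳ⇒inverseʳ)
  open import Relation.Binary.PropositionalEquality

  open FinAbGroup G public

  abelianGroup : AbelianGroup 0ℓ 0ℓ
  abelianGroup = record { isAbelianGroup = isAbelianGroup }

  open AbelianGroup abelianGroup public
    using (assoc; comm; identityˡ; identityʳ; inverseˡ; inverseʳ; commutativeMonoid; commutativeSemigroup)
  open AbelianGroupProperties abelianGroup public
  open CommutativeSemigroupProperties commutativeSemigroup public using (interchange)
  open ≡-Reasoning

  ^-+ : ∀ g a b → g ^ (a + b) ≡ g ^ a ∙ g ^ b
  ^-+ g zero    b = sym (identityˡ _)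
  ^-+ g (suc a) b = trans (cong (g ∙_) (^-+ g a b)) (sym (assoc _ _ _))

  ε^ : ∀ k → ε ^ k ≡ ε
  ε^ zero    = refl
  ε^ (suc k) = trans (identityˡ _) (ε^ k)

  ∙-^ : ∀ x y k → (x ∙ y) ^ k ≡ x ^ k ∙ y ^ k
  ∙-^ x y zero    = sym (identityˡ ε)
  ∙-^ x y (suc k) = trans (cong ((x ∙ y) ∙_) (∙-^ x y k)) (interchange x y _ _)

  ^-* : ∀ g a b → g ^ (a * b) ≡ (g ^ a) ^ b
  ^-* g zero    b = sym (ε^ b)
  ^-* g (suc a) b = begin
    g ^ (b + a * b)         ≡⟨ ^-+ g b (a * b) ⟩
    g ^ b ∙ g ^ (a * b)     ≡⟨ cong (g ^ b ∙_) (^-* g a b) ⟩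
    g ^ b ∙ (g ^ a) ^ b     ≡⟨ ∙-^ g (g ^ a) b ⟨
    (g ∙ g ^ a) ^ b         ∎

  ^-comm : ∀ g a b → (g ^ a) ^ b ≡ (g ^ b) ^ a
  ^-comm g a b = trans (sym (^-* g a b)) (trans (cong (g ^_) (ℕₚ.*-comm a b)) (^-* g b a))

  ^-*-comm : ∀ g a b → g ^ (a * b) ≡ (g ^ b) ^ a
  ^-*-comm g a b = trans (^-* g a b) (^-comm g a b)

  ⁻¹-^ : ∀ x k → (x ⁻¹) ^ k ≡ (x ^ k) ⁻¹
  ⁻¹-^ x zero    = sym ε⁻¹≈ε
  ⁻¹-^ x (suc k) = trans (cong (x ⁻¹ ∙_) (⁻¹-^ x k)) (⁻¹-∙-comm x (x ^ k))

  ^-1 : ∀ g → g ^ 1 ≡ g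
  ^-1 = identityʳ

  -- The product of all elements is invariant under translation by g.
  ^-order : ∀ g → g ^ n ≡ ε
  ^-order g = identityˡ-unique (g ^ n) Π (begin
    g ^ n ∙ Π                ≡⟨ product-translate (λ x → x) ⟨
    ∏ (λ x → g ∙ x)          ≡⟨ ∏-permute ⟨
    Π                        ∎)
    where
    open CommutativeMonoidSum commutativeMonoid using () renaming (sum to ∏; sum-permute to ∏-perm)
    Π : Fin n
    Π = ∏ (λ x → x)
    product-translate : ∀ {m} (v : Fin m → Fin n) → ∏ (λ i → g ∙ v i) ≡ g ^ m ∙ ∏ v
    product-translate {zero}  v = sym (identityˡ ε)
    product-translate {suc m} v = trans (cong ((g ∙ v Fin.zero) ∙_) (product-translate (v ∘ Fin.suc)))
                                        (interchange g (v Fin.zero) (g ^ m) _)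
    ∏-permute : Π ≡ ∏ (λ x → g ∙ x)
    ∏-permute = ∏-perm (λ x → x) (permutation (g ∙_) (g ⁻¹ ∙_) (\\-leftDividesˡ g) (\\-leftDividesʳ g))

  ^-*order : ∀ g k → g ^ (k * n) ≡ ε
  ^-*order g k = begin
    g ^ (k * n)    ≡⟨ cong (g ^_) (ℕₚ.*-comm k n) ⟩
    g ^ (n * k)    ≡⟨ ^-* g n k ⟩
    (g ^ n) ^ k    ≡⟨ cong (_^ k) (^-order g) ⟩
    ε ^ k          ≡⟨ ε^ k ⟩
    ε              ∎

  ^-+*order : ∀ g r k → g ^ (r + k * n) ≡ g ^ r
  ^-+*order g r k = trans (^-+ g r (k * n)) (trans (cong (g ^ r ∙_) (^-*order g k)) (identityʳ _))

  ⁻¹≡^pred[n] : ∀ x → x ⁻¹ ≡ x ^ (pred n)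
  ⁻¹≡^pred[n] x = sym (inverseʳ-unique x (x ^ (pred n)) (trans (cong (x ^_) (ℕₚ.suc-pred n {{nonZeroIndex ε}})) (^-order x)))

  ^-quotient : ∀ x a b → x ^ a ∙ (x ^ b) ⁻¹ ≡ x ^ (a + b * pred n)
  ^-quotient x a b = begin
    x ^ a ∙ (x ^ b) ⁻¹           ≡⟨ cong (x ^ a ∙_) (⁻¹≡^pred[n] (x ^ b)) ⟩
    x ^ a ∙ (x ^ b) ^ pred n     ≡⟨ cong (x ^ a ∙_) (^-* x b (pred n)) ⟨
    x ^ a ∙ x ^ (b * pred n)     ≡⟨ ^-+ x a (b * pred n) ⟨
    x ^ (a + b * pred n)         ∎

  module Homomorphism (σ : Fin n → Fin n) (σ-∙ : ∀ x y → σ (x ∙ y) ≡ σ x ∙ σ y) where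

    σ-ε : σ ε ≡ ε
    σ-ε = identityʳ-unique (σ ε) (σ ε) (trans (sym (σ-∙ ε ε)) (cong σ (identityˡ ε)))

    σ-^ : ∀ x k → σ (x ^ k) ≡ σ x ^ k
    σ-^ x zero    = σ-ε
    σ-^ x (suc k) = trans (σ-∙ x (x ^ k)) (cong (σ x ∙_) (σ-^ x k))

  coprime⇒^-invertible : ∀ {m} → Coprime m n → Σ ℕ λ m′ → ∀ u → (u ^ m) ^ m′ ≡ u
  coprime⇒^-invertible {m} m⊥n with coprime-Bézout m⊥n
  ... | Bézout.+- a b 1+bn≡am = a , λ u → begin
    (u ^ m) ^ a       ≡⟨ ^-* u m a ⟨
    u ^ (m * a)       ≡⟨ cong (u ^_) (trans (ℕₚ.*-comm m a) (sym 1+bn≡am)) ⟩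
    u ^ (1 + b * n)   ≡⟨ ^-+*order u 1 b ⟩
    u ^ 1             ≡⟨ ^-1 u ⟩
    u                 ∎
  ... | Bézout.-+ a b 1+am≡bn = a * (pred n) , λ u → begin
    (u ^ m) ^ (a * (pred n))    ≡⟨ ^-* (u ^ m) a (pred n) ⟩
    ((u ^ m) ^ a) ^ (pred n)    ≡⟨ cong (_^ (pred n)) (u^ma≡u⁻¹ u) ⟩
    (u ⁻¹) ^ (pred n)           ≡⟨ ⁻¹≡^pred[n] (u ⁻¹) ⟨
    u ⁻¹ ⁻¹                    ≡⟨ ⁻¹-involutive u ⟩
    u                          ∎
    where
    u^ma≡u⁻¹ : ∀ u → (u ^ m) ^ a ≡ u ⁻¹
    u^ma≡u⁻¹ u = inverseʳ-unique u ((u ^ m) ^ a) (begin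
      u ∙ (u ^ m) ^ a       ≡⟨ cong (u ∙_) (trans (cong (u ^_) (ℕₚ.*-comm a m)) (^-* u m a)) ⟨
      u ^ (1 + a * m)       ≡⟨ cong (u ^_) 1+am≡bn ⟩
      u ^ (b * n)           ≡⟨ ^-*order u b ⟩
      ε                     ∎)

  coprime⇒^-isAutomorphism : ∀ {m} → Coprime m n → IsAutomorphism (_^ m)
  coprime⇒^-isAutomorphism {m} m⊥n with coprime⇒^-invertible m⊥n
  ... | m′ , ^m′∘^m≗id = (λ x y → ∙-^ x y m) , inverseᵇ⇒bijective
    ( strictlyInverseˡ⇒inverseˡ (_^ m) (λ u → trans (^-comm u m′ m) (^m′∘^m≗id u))
    , strictlyInverseʳ⇒inverseʳ (_^ m) ^m′∘^m≗id )

  ∙-swap : ∀ {a b c d} → a ∙ b ≡ c ∙ d → b ∙ d ⁻¹ ≡ a ⁻¹ ∙ c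
  ∙-swap {a} {b} {c} {d} a∙b≡c∙d = begin
    b ∙ d ⁻¹                 ≡⟨ cong (_∙ d ⁻¹) (y≈x\\z a b (c ∙ d) a∙b≡c∙d) ⟩
    a ⁻¹ ∙ (c ∙ d) ∙ d ⁻¹    ≡⟨ cong (_∙ d ⁻¹) (assoc (a ⁻¹) c d) ⟨
    a ⁻¹ ∙ c ∙ d ∙ d ⁻¹      ≡⟨ //-rightDividesʳ d (a ⁻¹ ∙ c) ⟩
    a ⁻¹ ∙ c                 ∎

  x∙[x∙w⁻¹]⁻¹≡w : ∀ x w → x ∙ (x ∙ w ⁻¹) ⁻¹ ≡ w
  x∙[x∙w⁻¹]⁻¹≡w x w = begin
    x ∙ (x ∙ w ⁻¹) ⁻¹    ≡⟨ cong (x ∙_) (⁻¹-anti-homo-// x w) ⟩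
    x ∙ (w ∙ x ⁻¹)       ≡⟨ assoc x w (x ⁻¹) ⟨
    x ∙ w ∙ x ⁻¹         ≡⟨ xyx⁻¹≈y x w ⟩
    w                    ∎

  ^-injective-∣ : ∀ {d m} → d ∣ m → (∀ {x y} → x ^ m ≡ y ^ m → x ≡ y) → ∀ {x y} → x ^ d ≡ y ^ d → x ≡ y
  ^-injective-∣ {d} (divides t refl) ^m-injective {x} {y} x^d≡y^d = ^m-injective (begin
    x ^ (t * d)     ≡⟨ ^-*-comm x t d ⟩
    (x ^ d) ^ t     ≡⟨ cong (_^ t) x^d≡y^d ⟩
    (y ^ d) ^ t     ≡⟨ ^-*-comm y t d ⟨
    y ^ (t * d)     ∎)

module GroupSemiring {n : ℕ} (G : FinAbGroup n) where

  open import Level using (0ℓ)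
  open import Algebra.Bundles using (CommutativeSemiring)
  open import Data.Empty using (⊥-elim)
  open import Data.Fin as Fin using (Fin)
  open import Data.Fin.Permutation using (permutation)
  open import Data.Fin.Properties using (_≟_)
  open import Data.List using ([]; _∷_)
  open import Data.List.Relation.Unary.All using (All; []; _∷_)
  open import Data.Nat as ℕ using (zero; suc; _+_; _*_; _≤_)
  import Data.Nat.Properties as ℕₚ
  open import Data.Nat.Divisibility using (_∣_; divides; ∣-trans; ∣1⇒≡1; ∣m+n∣m⇒∣n; m∣m*n; n∣m*n)
  open import Data.Nat.ListAction using (product)
  open import Data.Nat.Primality using (Prime; prime⇒nonTrivial)
  open import Data.Product using (Σ; proj₁; proj₂)
  open import Data.Unit using (⊤; tt)
  open import Function using (_∘_; id)
  open import Relation.Binary.Bundles using (Setoid)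
  open import Relation.Nullary using (Dec; yes; no; ¬_)
  open import Relation.Binary.PropositionalEquality
  open Arithmetic using (prime∣^⇒prime∣)
  open Counting

  open FinAbGroupProperties G
  open ≡-Reasoning

  ℕ[G] : Set
  ℕ[G] = Fin n → ℕ

  infixl 6 _⊕_
  infixl 7 _⋆_

  _⊕_ : ℕ[G] → ℕ[G] → ℕ[G]
  (f ⊕ g) x = f x + g x

  _⋆_ : ℕ[G] → ℕ[G] → ℕ[G]
  (f ⋆ g) x = ∑ (λ y → f y * g (x ∙ y ⁻¹))

  𝟘 : ℕ[G]
  𝟘 _ = 0

  δ : Fin n → ℕ[G]
  δ a y = indicator (y ≟ a)


  ∑-translate : ∀ (f : ℕ[G]) a → ∑ f ≡ ∑ (λ w → f (w ∙ a))
  ∑-translate f a = ∑-permute f (permutation (_∙ a) (_∙ a ⁻¹) (//-rightDividesˡ a) (//-rightDividesʳ a))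

  ∑-reflect : ∀ (f : ℕ[G]) x → ∑ f ≡ ∑ (λ w → f (x ∙ w ⁻¹))
  ∑-reflect f x =
    ∑-permute f (permutation (λ w → x ∙ w ⁻¹) (λ w → x ∙ w ⁻¹) (x∙[x∙w⁻¹]⁻¹≡w x) (x∙[x∙w⁻¹]⁻¹≡w x))

  ⋆-comm : ∀ f g x → (f ⋆ g) x ≡ (g ⋆ f) x
  ⋆-comm f g x = begin
    ∑ (λ y → f y * g (x ∙ y ⁻¹))                       ≡⟨ ∑-reflect (λ y → f y * g (x ∙ y ⁻¹)) x ⟩
    ∑ (λ w → f (x ∙ w ⁻¹) * g (x ∙ (x ∙ w ⁻¹) ⁻¹))     ≡⟨ ∑-cong (λ w → cong (λ z → f (x ∙ w ⁻¹) * g z) (x∙[x∙w⁻¹]⁻¹≡w x w)) ⟩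
    ∑ (λ w → f (x ∙ w ⁻¹) * g w)                       ≡⟨ ∑-cong (λ w → ℕₚ.*-comm (f _) (g w)) ⟩
    ∑ (λ w → g w * f (x ∙ w ⁻¹))                       ∎

  ⋆-assoc : ∀ f g h x → ((f ⋆ g) ⋆ h) x ≡ (f ⋆ (g ⋆ h)) x
  ⋆-assoc f g h x = begin
    ∑ (λ y → ∑ (λ z → f z * g (y ∙ z ⁻¹)) * h (x ∙ y ⁻¹))
      ≡⟨ ∑-cong (λ y → sym (∑-*ʳ (h (x ∙ y ⁻¹)) (λ z → f z * g (y ∙ z ⁻¹)))) ⟩
    ∑ (λ y → ∑ (λ z → f z * g (y ∙ z ⁻¹) * h (x ∙ y ⁻¹)))
      ≡⟨ ∑-swap (λ y z → f z * g (y ∙ z ⁻¹) * h (x ∙ y ⁻¹)) ⟩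
    ∑ (λ z → ∑ (λ y → f z * g (y ∙ z ⁻¹) * h (x ∙ y ⁻¹)))
      ≡⟨ ∑-cong (λ z → trans (∑-cong (λ y → ℕₚ.*-assoc (f z) (g (y ∙ z ⁻¹)) (h (x ∙ y ⁻¹))))
                             (∑-*ˡ (f z) (λ y → g (y ∙ z ⁻¹) * h (x ∙ y ⁻¹)))) ⟩
    ∑ (λ z → f z * ∑ (λ y → g (y ∙ z ⁻¹) * h (x ∙ y ⁻¹)))
      ≡⟨ ∑-cong (λ z → cong (f z *_) (∑-translate (λ y → g (y ∙ z ⁻¹) * h (x ∙ y ⁻¹)) z)) ⟩
    ∑ (λ z → f z * ∑ (λ w → g ((w ∙ z) ∙ z ⁻¹) * h (x ∙ (w ∙ z) ⁻¹)))
      ≡⟨ ∑-cong (λ z → cong (f z *_) (∑-cong (λ w → cong₂ _*_ (cong g (//-rightDividesʳ z w)) (cong h (shift z w))))) ⟩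
    ∑ (λ z → f z * ∑ (λ w → g w * h ((x ∙ z ⁻¹) ∙ w ⁻¹)))
      ∎
    where
    shift : ∀ z w → x ∙ (w ∙ z) ⁻¹ ≡ (x ∙ z ⁻¹) ∙ w ⁻¹
    shift z w = begin
      x ∙ (w ∙ z) ⁻¹          ≡⟨ cong (x ∙_) (⁻¹-anti-homo-∙ w z) ⟩
      x ∙ (z ⁻¹ ∙ w ⁻¹)       ≡⟨ assoc x _ _ ⟨
      x ∙ z ⁻¹ ∙ w ⁻¹         ∎

  δ-⋆ : ∀ a f x → (δ a ⋆ f) x ≡ f (x ∙ a ⁻¹)
  δ-⋆ a f x = ∑-δ a (λ y → f (x ∙ y ⁻¹))

  ⋆-identityˡ : ∀ f x → (δ ε ⋆ f) x ≡ f x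
  ⋆-identityˡ f x = trans (δ-⋆ ε f x) (cong f (trans (cong (x ∙_) ε⁻¹≈ε) (identityʳ x)))

  ⋆-distribˡ : ∀ f g h x → (f ⋆ (g ⊕ h)) x ≡ ((f ⋆ g) ⊕ (f ⋆ h)) x
  ⋆-distribˡ f g h x = trans (∑-cong (λ y → ℕₚ.*-distribˡ-+ (f y) (g (x ∙ y ⁻¹)) (h (x ∙ y ⁻¹))))
                             (∑-+ (λ y → f y * g (x ∙ y ⁻¹)) (λ y → f y * h (x ∙ y ⁻¹)))

  ⋆-zeroˡ : ∀ f x → (𝟘 ⋆ f) x ≡ 0
  ⋆-zeroˡ f x = ∑-0 n

  ⋆-zeroʳ : ∀ f x → (f ⋆ 𝟘) x ≡ 0
  ⋆-zeroʳ f x = trans (∑-cong (λ y → ℕₚ.*-zeroʳ (f y))) (∑-0 n)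

  commutativeSemiring : CommutativeSemiring 0ℓ 0ℓ
  commutativeSemiring = record
    { Carrier = ℕ[G] ; _≈_ = _≗_ ; _+_ = _⊕_ ; _*_ = _⋆_ ; 0# = 𝟘 ; 1# = δ ε
    ; isCommutativeSemiring = isCommutativeSemiring }
    where
    open import Algebra.Structures {A = ℕ[G]} _≗_
    open import Algebra.Consequences.Setoid (Fin n →-setoid ℕ) using (comm∧distrˡ⇒distrʳ; comm∧idˡ⇒idʳ)
    ⊕-cong : ∀ {f f′ g g′} → f ≗ f′ → g ≗ g′ → (f ⊕ g) ≗ (f′ ⊕ g′)
    ⊕-cong f≗f′ g≗g′ x = cong₂ _+_ (f≗f′ x) (g≗g′ x)
    ⊕-isCommutativeMonoid : IsCommutativeMonoid _⊕_ 𝟘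
    ⊕-isCommutativeMonoid = record
      { isMonoid = record
        { isSemigroup = record
          { isMagma = record { isEquivalence = Setoid.isEquivalence (Fin n →-setoid ℕ)
                             ; ∙-cong = ⊕-cong }
          ; assoc = λ f g h x → ℕₚ.+-assoc (f x) (g x) (h x) }
        ; identity = (λ f x → refl) , (λ f x → ℕₚ.+-identityʳ (f x)) }
      ; comm = λ f g x → ℕₚ.+-comm (f x) (g x) }
    isCommutativeSemiring : IsCommutativeSemiring _⊕_ _⋆_ 𝟘 (δ ε)
    isCommutativeSemiring = record
      { isSemiring = record
        { isSemiringWithoutAnnihilatingZero = record
          { +-isCommutativeMonoid = ⊕-isCommutativeMonoid
          ; *-cong = λ f≗f′ g≗g′ x → ∑-cong (λ y → cong₂ _*_ (f≗f′ y) (g≗g′ (x ∙ y ⁻¹)))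
          ; *-assoc = ⋆-assoc
          ; *-identity = ⋆-identityˡ , comm∧idˡ⇒idʳ ⋆-comm {e = δ ε} ⋆-identityˡ
          ; distrib = ⋆-distribˡ , comm∧distrˡ⇒distrʳ {_∙_ = _⋆_} ⊕-cong ⋆-comm ⋆-distribˡ }
        ; zero = ⋆-zeroˡ , ⋆-zeroʳ }
      ; *-comm = ⋆-comm }

  open import Algebra.Properties.Semiring.Exp (CommutativeSemiring.semiring commutativeSemiring)
    using () renaming (_^_ to _^ᴿ_; ^-congˡ to ^ᴿ-congˡ)
  open import Algebra.Properties.Semiring.Mult (CommutativeSemiring.semiring commutativeSemiring)
    using () renaming (_×_ to _·_)
  open import Algebra.Properties.Monoid.Sum (CommutativeSemiring.+-monoid commutativeSemiring)
    using () renaming (sum to ∑ᴿ)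
  open FreshmansDream commutativeSemiring using (^-sum-prime)

  ones : ℕ[G]
  ones _ = 1

  ∑-ones : ∑ ones ≡ n
  ∑-ones = ∑-1 n

  ⋆-ones : ∀ f x → (f ⋆ ones) x ≡ ∑ f
  ⋆-ones f x = ∑-cong (λ y → ℕₚ.*-identityʳ (f y))

  ∑-⋆ : ∀ f g → ∑ (f ⋆ g) ≡ ∑ f * ∑ g
  ∑-⋆ f g = begin
    ∑ (λ x → ∑ (λ y → f y * g (x ∙ y ⁻¹)))   ≡⟨ ∑-swap (λ x y → f y * g (x ∙ y ⁻¹)) ⟩
    ∑ (λ y → ∑ (λ x → f y * g (x ∙ y ⁻¹)))   ≡⟨ ∑-cong (λ y → ∑-*ˡ (f y) (λ x → g (x ∙ y ⁻¹))) ⟩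
    ∑ (λ y → f y * ∑ (λ x → g (x ∙ y ⁻¹)))   ≡⟨ ∑-cong (λ y → cong (f y *_) (∑-translate g (y ⁻¹))) ⟨
    ∑ (λ y → f y * ∑ g)                      ≡⟨ ∑-*ʳ (∑ g) f ⟩
    ∑ f * ∑ g                                ∎

  ∑-δ-1 : ∀ a → ∑ (δ a) ≡ 1
  ∑-δ-1 a = trans (∑-cong {g = λ y → indicator (y ≟ a) * 1} (λ y → sym (ℕₚ.*-identityʳ _))) (∑-δ a (λ _ → 1))

  ∑-^ᴿ : ∀ f k → ∑ (f ^ᴿ k) ≡ ∑ f ℕ.^ k
  ∑-^ᴿ f zero    = ∑-δ-1 ε
  ∑-^ᴿ f (suc k) = trans (∑-⋆ f (f ^ᴿ k)) (cong (∑ f *_) (∑-^ᴿ f k))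

  ·-eval : ∀ m f x → (m · f) x ≡ m * f x
  ·-eval zero    f x = refl
  ·-eval (suc m) f x = cong (f x +_) (·-eval m f x)

  ∑ᴿ-eval : ∀ {k} (fs : Fin k → ℕ[G]) x → ∑ᴿ fs x ≡ ∑ (λ i → fs i x)
  ∑ᴿ-eval {zero}  fs x = refl
  ∑ᴿ-eval {suc k} fs x = cong (fs Fin.zero x +_) (∑ᴿ-eval (fs ∘ Fin.suc) x)

  ⋆-congʳ : ∀ f {g h} → g ≗ h → (f ⋆ g) ≗ (f ⋆ h)
  ⋆-congʳ f g≗h x = ∑-cong (λ y → cong (f y *_) (g≗h (x ∙ y ⁻¹)))

  δ-⋆-δ : ∀ a b → (δ a ⋆ δ b) ≗ δ (a ∙ b)
  δ-⋆-δ a b x = trans (δ-⋆ a (δ b) x) (indicator-cong (x ∙ a ⁻¹ ≟ b) (x ≟ a ∙ b)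
    (λ x/a≡b → trans (sym (//-rightDividesˡ a x)) (trans (cong (_∙ a) x/a≡b) (comm b a)))
    (λ x≡ab → sym (x≈z//y b a x (trans (comm b a) (sym x≡ab)))))

  δ-^ᴿ : ∀ a k → (δ a ^ᴿ k) ≗ δ (a ^ k)
  δ-^ᴿ a zero    x = refl
  δ-^ᴿ a (suc k) x = trans (⋆-congʳ (δ a) (δ-^ᴿ a k) x) (δ-⋆-δ a (a ^ k) x)

  masked-δ-^ᴿ : ∀ {P : Set} (P? : Dec P) a q →
                ((indicator P? · δ a) ^ᴿ suc q) ≗ (indicator P? · δ (a ^ suc q))
  masked-δ-^ᴿ (yes _) a q x = begin
    ((δ a ⊕ 𝟘) ^ᴿ suc q) x     ≡⟨ ^ᴿ-congˡ (suc q) (λ y → ℕₚ.+-identityʳ (δ a y)) x ⟩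
    (δ a ^ᴿ suc q) x           ≡⟨ δ-^ᴿ a (suc q) x ⟩
    δ (a ^ suc q) x            ≡⟨ ℕₚ.+-identityʳ _ ⟨
    δ (a ^ suc q) x + 0        ∎
  masked-δ-^ᴿ (no _)  a q x = ⋆-zeroˡ ((𝟘 ⊕ 𝟘) ^ᴿ q) x

  ⋆-congˡ : ∀ β {f g} → f ≗ g → (f ⋆ β) ≗ (g ⋆ β)
  ⋆-congˡ β f≗g x = ∑-cong (λ y → cong (_* β (x ∙ y ⁻¹)) (f≗g y))

  ⋆-split : ∀ {f F H} p β → (∀ y → f y ≡ F y + p * H y) → ∀ x → (f ⋆ β) x ≡ (F ⋆ β) x + p * (H ⋆ β) x
  ⋆-split {f} {F} {H} p β f≡F+pH x = begin
    ∑ (λ y → f y * β (x ∙ y ⁻¹))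
      ≡⟨ ∑-cong (λ y → cong (_* β (x ∙ y ⁻¹)) (f≡F+pH y)) ⟩
    ∑ (λ y → (F y + p * H y) * β (x ∙ y ⁻¹))
      ≡⟨ ∑-cong (λ y → trans (ℕₚ.*-distribʳ-+ (β (x ∙ y ⁻¹)) (F y) (p * H y))
                             (cong (F y * β (x ∙ y ⁻¹) +_) (ℕₚ.*-assoc p (H y) (β (x ∙ y ⁻¹))))) ⟩
    ∑ (λ y → F y * β (x ∙ y ⁻¹) + p * (H y * β (x ∙ y ⁻¹)))
      ≡⟨ ∑-+ (λ y → F y * β (x ∙ y ⁻¹)) (λ y → p * (H y * β (x ∙ y ⁻¹))) ⟩
    (F ⋆ β) x + ∑ (λ y → p * (H y * β (x ∙ y ⁻¹)))
      ≡⟨ cong ((F ⋆ β) x +_) (∑-*ˡ p (λ y → H y * β (x ∙ y ⁻¹))) ⟩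
    (F ⋆ β) x + p * (H ⋆ β) x
      ∎

  ^ᴿ-⋆-tiles : ∀ f β q → (f ⋆ β) ≗ ones → ∀ x → (f ^ᴿ suc q ⋆ β) x ≡ ∑ f ℕ.^ q
  ^ᴿ-⋆-tiles f β q tiles x = begin
    ((f ⋆ f ^ᴿ q) ⋆ β) x      ≡⟨ ⋆-congˡ β (⋆-comm f (f ^ᴿ q)) x ⟩
    ((f ^ᴿ q ⋆ f) ⋆ β) x      ≡⟨ ⋆-assoc (f ^ᴿ q) f β x ⟩
    (f ^ᴿ q ⋆ (f ⋆ β)) x      ≡⟨ ⋆-congʳ (f ^ᴿ q) tiles x ⟩
    (f ^ᴿ q ⋆ ones) x         ≡⟨ ⋆-ones (f ^ᴿ q) x ⟩
    ∑ (f ^ᴿ q)                ≡⟨ ∑-^ᴿ f q ⟩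
    ∑ f ℕ.^ q                 ∎

  module Pushforward {C : Fin n → Set} (C? : ∀ i → Dec (C i)) where

    -- The image of 1_C under σ, with multiplicities: 1_C is push id and 1_{C^(p)} is push (_^ p).
    push : (Fin n → Fin n) → ℕ[G]
    push σ = ∑ᴿ (λ i → indicator (C? i) · δ (σ i))

    push-eval : ∀ σ y → push σ y ≡ ∑ (λ i → indicator (C? i) * δ (σ i) y)
    push-eval σ y = trans (∑ᴿ-eval (λ i → indicator (C? i) · δ (σ i)) y)
                          (∑-cong (λ i → ·-eval (indicator (C? i)) (δ (σ i)) y))

    push-⋆ : ∀ σ f x → (push σ ⋆ f) x ≡ ∑ (λ i → indicator (C? i) * f (x ∙ σ i ⁻¹))
    push-⋆ σ f x = begin
      ∑ (λ y → push σ y * f (x ∙ y ⁻¹))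
        ≡⟨ ∑-cong (λ y → trans (cong (_* f (x ∙ y ⁻¹)) (push-eval σ y))
                               (sym (∑-*ʳ (f (x ∙ y ⁻¹)) (λ i → indicator (C? i) * δ (σ i) y)))) ⟩
      ∑ (λ y → ∑ (λ i → indicator (C? i) * δ (σ i) y * f (x ∙ y ⁻¹)))
        ≡⟨ ∑-swap (λ y i → indicator (C? i) * δ (σ i) y * f (x ∙ y ⁻¹)) ⟩
      ∑ (λ i → ∑ (λ y → indicator (C? i) * δ (σ i) y * f (x ∙ y ⁻¹)))
        ≡⟨ ∑-cong (λ i → trans (∑-cong (λ y → ℕₚ.*-assoc (indicator (C? i)) (δ (σ i) y) (f (x ∙ y ⁻¹))))
                               (∑-*ˡ (indicator (C? i)) (λ y → δ (σ i) y * f (x ∙ y ⁻¹)))) ⟩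
      ∑ (λ i → indicator (C? i) * (δ (σ i) ⋆ f) x)
        ≡⟨ ∑-cong (λ i → cong (indicator (C? i) *_) (δ-⋆ (σ i) f x)) ⟩
      ∑ (λ i → indicator (C? i) * f (x ∙ σ i ⁻¹))
        ∎

    ∑-push : ∀ σ → ∑ (push σ) ≡ count C?
    ∑-push σ = begin
      ∑ (push σ)                                         ≡⟨ ⋆-ones (push σ) ε ⟨
      (push σ ⋆ ones) ε                                  ≡⟨ push-⋆ σ ones ε ⟩
      ∑ (λ i → indicator (C? i) * 1)                     ≡⟨ ∑-cong (λ i → ℕₚ.*-identityʳ (indicator (C? i))) ⟩
      count C?                                           ∎

    push-cong : ∀ {σ τ} → (∀ i → σ i ≡ τ i) → push σ ≗ push τ
    push-cong {σ} {τ} σ≗τ y = trans (push-eval σ y) (trans (∑-cong (λ i → cong (λ a → indicator (C? i) * δ a y) (σ≗τ i)))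
                                                   (sym (push-eval τ y)))

    push-^ᴿ-prime : ∀ {p} → Prime p → ∀ σ → Σ ℕ[G] λ H → ∀ y → (push σ ^ᴿ p) y ≡ push (λ i → σ i ^ p) y + p * H y
    push-^ᴿ-prime {p@(suc q)} pp σ with ^-sum-prime pp (λ i → indicator (C? i) · δ (σ i))
    ... | H , push^p≗ = H , λ y → begin
      (push σ ^ᴿ p) y                                                ≡⟨ push^p≗ y ⟩
      ∑ᴿ (λ i → (indicator (C? i) · δ (σ i)) ^ᴿ p) y + (p · H) y   ≡⟨ cong₂ _+_ (frobenius y) (·-eval p H y) ⟩
      push (λ i → σ i ^ p) y + p * H y                               ∎
      where
      frobenius : ∀ y → ∑ᴿ (λ i → (indicator (C? i) · δ (σ i)) ^ᴿ p) y ≡ push (λ i → σ i ^ p) y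
      frobenius y = trans (∑ᴿ-eval (λ i → (indicator (C? i) · δ (σ i)) ^ᴿ p) y)
                          (trans (∑-cong (λ i → masked-δ-^ᴿ (C? i) (σ i) q y))
                                 (sym (∑ᴿ-eval (λ i → indicator (C? i) · δ (σ i ^ p)) y)))

    push-⋆-transfer : ∀ {p} → Prime p → ¬ p ∣ n → ∀ σ β →
                      (push σ ⋆ β) ≗ ones → (push (λ i → σ i ^ p) ⋆ β) ≗ ones
    push-⋆-transfer {p@(suc q)} pp p∤n σ β tiles = all≥1∧∑≡length⇒≡1 (F ⋆ β) positive ∑F⋆β≡n
      where
      f F H : ℕ[G]
      f = push σ
      F = push (λ i → σ i ^ p)
      H = proj₁ (push-^ᴿ-prime pp σ)
      ∑f*∑β≡n : ∑ f * ∑ β ≡ n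
      ∑f*∑β≡n = trans (sym (∑-⋆ f β)) (trans (∑-cong tiles) ∑-ones)
      positive : ∀ x → 1 ≤ (F ⋆ β) x
      positive x with (F ⋆ β) x in F⋆β[x]≡
      ... | suc _ = ℕ.s≤s ℕ.z≤n
      ... | zero  = ⊥-elim (p∤n (∣-trans p∣∑f (divides (∑ β) (trans (sym ∑f*∑β≡n) (ℕₚ.*-comm (∑ f) (∑ β))))))
        where
        p∣∑f : p ∣ ∑ f
        p∣∑f = prime∣^⇒prime∣ pp (∑ f) q (divides ((H ⋆ β) x) (begin
          ∑ f ℕ.^ q                   ≡⟨ ^ᴿ-⋆-tiles f β q tiles x ⟨
          (f ^ᴿ p ⋆ β) x              ≡⟨ ⋆-split {f ^ᴿ p} {F} {H} p β (proj₂ (push-^ᴿ-prime pp σ)) x ⟩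
          (F ⋆ β) x + p * (H ⋆ β) x   ≡⟨ cong (_+ p * (H ⋆ β) x) F⋆β[x]≡ ⟩
          p * (H ⋆ β) x               ≡⟨ ℕₚ.*-comm p _ ⟩
          (H ⋆ β) x * p               ∎))
      ∑F⋆β≡n : ∑ (F ⋆ β) ≡ n
      ∑F⋆β≡n = begin
        ∑ (F ⋆ β)        ≡⟨ ∑-⋆ F β ⟩
        ∑ F * ∑ β        ≡⟨ cong (_* ∑ β) (trans (∑-push _) (sym (∑-push σ))) ⟩
        ∑ f * ∑ β        ≡⟨ ∑f*∑β≡n ⟩
        n                ∎

  ^-injective⇒prime∤order : ∀ {p} → Prime p → (∀ {x y} → x ^ p ≡ y ^ p → x ≡ y) → ¬ p ∣ n
  ^-injective⇒prime∤order {p@(suc q@(suc _))} pp ^p-injective p∣n =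
    ℕ.nonTrivial⇒≢1 {{prime⇒nonTrivial pp}} (∣1⇒≡1 (∣m+n∣m⇒∣n p∣pH+1 (m∣m*n (H ε))))
    where
    open Pushforward {C = λ _ → ⊤} (λ _ → yes tt)
    f : ℕ[G]
    f = push id
    H = proj₁ (push-^ᴿ-prime pp id)
    f^p[ε]≡n^q : (f ^ᴿ p) ε ≡ n ℕ.^ q
    f^p[ε]≡n^q = begin
      (f ⋆ f ^ᴿ q) ε                          ≡⟨ push-⋆ id (f ^ᴿ q) ε ⟩
      ∑ (λ i → 1 * (f ^ᴿ q) (ε ∙ i ⁻¹))       ≡⟨ ∑-cong (λ i → ℕₚ.*-identityˡ ((f ^ᴿ q) (ε ∙ i ⁻¹))) ⟩
      ∑ (λ i → (f ^ᴿ q) (ε ∙ i ⁻¹))           ≡⟨ ∑-reflect (f ^ᴿ q) ε ⟨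
      ∑ (f ^ᴿ q)                              ≡⟨ ∑-^ᴿ f q ⟩
      ∑ f ℕ.^ q                               ≡⟨ cong (ℕ._^ q) (trans (∑-push id) (∑-1 n)) ⟩
      n ℕ.^ q                                 ∎
    i^p≡ε⇒i≡ε : ∀ i → ε ≡ i ^ p → i ≡ ε
    i^p≡ε⇒i≡ε i ε≡i^p = ^p-injective (trans (sym ε≡i^p) (sym (ε^ p)))
    push[^p][ε]≡1 : push (_^ p) ε ≡ 1
    push[^p][ε]≡1 = begin
      push (_^ p) ε                             ≡⟨ push-eval (_^ p) ε ⟩
      ∑ (λ i → 1 * indicator (ε ≟ i ^ p))       ≡⟨ ∑-single (λ i → 1 * indicator (ε ≟ i ^ p)) ε
                                                     (λ i i≢ε → cong (1 *_) (indicator-no (ε ≟ i ^ p) (i≢ε ∘ i^p≡ε⇒i≡ε i))) ⟩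
      1 * indicator (ε ≟ ε ^ p)                 ≡⟨ cong (1 *_) (indicator-yes (ε ≟ ε ^ p) (sym (ε^ p))) ⟩
      1                                         ∎
    p∣pH+1 : p ∣ p * H ε + 1
    p∣pH+1 = subst (p ∣_) (begin
      n ℕ.^ q                    ≡⟨ f^p[ε]≡n^q ⟨
      (f ^ᴿ p) ε                 ≡⟨ proj₂ (push-^ᴿ-prime pp id) ε ⟩
      push (_^ p) ε + p * H ε    ≡⟨ cong (_+ p * H ε) push[^p][ε]≡1 ⟩
      1 + p * H ε                ≡⟨ ℕₚ.+-comm 1 (p * H ε) ⟩
      p * H ε + 1                ∎) (∣-trans p∣n (m∣m*n _))

  module _ {C : Fin n → Set} (C? : ∀ i → Dec (C i)) where

    open Pushforward C?

    push-⋆-transfer-product : ∀ ps → All Prime ps → (∀ {x y} → x ^ product ps ≡ y ^ product ps → x ≡ y) →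
                              ∀ σ β → (push σ ⋆ β) ≗ ones → (push (λ i → σ i ^ product ps) ⋆ β) ≗ ones
    push-⋆-transfer-product [] [] _ σ β tiles x =
      trans (⋆-congˡ β (push-cong (λ i → ^-1 (σ i))) x) (tiles x)
    push-⋆-transfer-product (p ∷ ps) (p-prime ∷ ps-prime) ^pps-injective σ β tiles x = begin
      (push (λ i → σ i ^ (p * product ps)) ⋆ β) x
        ≡⟨ ⋆-congˡ β (push-cong (λ i → ^-* (σ i) p (product ps))) x ⟩
      (push (λ i → (σ i ^ p) ^ product ps) ⋆ β) x
        ≡⟨ push-⋆-transfer-product ps ps-prime ^ps-injective (λ i → σ i ^ p) β
             (push-⋆-transfer p-prime (^-injective⇒prime∤order p-prime ^p-injective) σ β tiles) x ⟩
      1 ∎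
      where
      ^p-injective = ^-injective-∣ {p} (m∣m*n (product ps)) ^pps-injective
      ^ps-injective = ^-injective-∣ {product ps} (n∣m*n p) ^pps-injective

module PowerAutomorphisms {n : ℕ} (G : FinAbGroup n) where

  open import Data.Empty using (⊥-elim)
  open import Data.Fin as Fin using (Fin; toℕ; fromℕ<)
  open import Data.Fin.Properties using (_≟_; any?; toℕ-fromℕ<; nonZeroIndex)
  open import Data.List using (allFin)
  open import Data.List.Extrema.Nat using (argmax; f[xs]≤f[argmax])
  open import Data.List.Membership.Propositional.Properties using (∈-allFin)
  open import Data.List.Relation.Unary.All using (lookup)
  open import Data.Nat as ℕ using (zero; suc; _+_; _*_; _≤_; s≤s; z≤n; pred; NonZero)
  import Data.Nat.Properties as ℕₚ
  open import Data.Nat.DivMod using (_%_; _/_; m%n<n; m≡m%n+[m/n]*n)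
  open import Data.Nat.Divisibility using (_∣_; divides; ∣⇒≤)
  open import Data.Product using (Σ; ∃-syntax; proj₁; proj₂)
  open import Function using (_∘_)
  open import Relation.Nullary using (Dec; yes; no; ¬_)
  open import Relation.Binary.PropositionalEquality
  open Arithmetic using (least-witness)

  open FinAbGroupProperties G
  open ≡-Reasoning

  record IsSubgroup (H : Subset) : Set where
    field
      ε∈        : H ε
      ∙-closed  : ∀ {x y} → H x → H y → H (x ∙ y)
      ⁻¹-closed : ∀ {x} → H x → H (x ⁻¹)

    ^-closed : ∀ {x} → H x → ∀ k → H (x ^ k)
    ^-closed Hx zero    = ε∈
    ^-closed Hx (suc k) = ∙-closed Hx (^-closed Hx k)

  record RelativeOrder (H : Subset) (x : Fin n) : Set where
    field
      index     : ℕ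
      0<index   : 0 < index
      ^index∈   : H (x ^ index)
      index∣    : ∀ m → H (x ^ m) → index ∣ m

  -- Opaque: later proofs use only the fields, and unfolding the search is prohibitively slow.
  opaque
    relativeOrder : ∀ {H} → IsSubgroup H → (∀ z → Dec (H z)) → ∀ x → RelativeOrder H x
    relativeOrder {H} H-subgroup H? x = record
      { index = suc c ; 0<index = s≤s z≤n ; ^index∈ = x^[1+c]∈H ; index∣ = index∣ }
      where
      open IsSubgroup H-subgroup
      least : Σ ℕ λ m → H (x ^ suc m) × (∀ k → k < m → ¬ H (x ^ suc k))
      least = least-witness (λ k → H? (x ^ suc k)) (pred n)
                (subst H (sym (trans (cong (x ^_) (ℕₚ.suc-pred n {{nonZeroIndex ε}})) (^-order x))) ε∈)
      c : ℕ
      c = proj₁ least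
      x^[1+c]∈H : H (x ^ suc c)
      x^[1+c]∈H = proj₁ (proj₂ least)
      index∣ : ∀ m → H (x ^ m) → suc c ∣ m
      index∣ m x^m∈H with m % suc c in m%≡ | m%n<n m (suc c)
      ... | zero     | _       = divides (m / suc c) (trans (m≡m%n+[m/n]*n m (suc c)) (cong (_+ (m / suc c) * suc c) m%≡))
      ... | suc r    | r<c     = ⊥-elim (proj₂ (proj₂ least) r (ℕₚ.≤-pred r<c) x^r∈H)
        where
        t : ℕ
        t = m / suc c
        x^m≡x^[1+r]∙[x^c]^t : x ^ m ≡ x ^ suc r ∙ (x ^ suc c) ^ t
        x^m≡x^[1+r]∙[x^c]^t = begin
          x ^ m                               ≡⟨ cong (x ^_) (m≡m%n+[m/n]*n m (suc c)) ⟩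
          x ^ (m % suc c + t * suc c)         ≡⟨ cong (λ r′ → x ^ (r′ + t * suc c)) m%≡ ⟩
          x ^ (suc r + t * suc c)             ≡⟨ ^-+ x (suc r) (t * suc c) ⟩
          x ^ suc r ∙ x ^ (t * suc c)         ≡⟨ cong (x ^ suc r ∙_) (^-*-comm x t (suc c)) ⟩
          x ^ suc r ∙ (x ^ suc c) ^ t         ∎
        x^r∈H : H (x ^ suc r)
        x^r∈H = subst H (sym (x≈z//y _ _ _ (sym x^m≡x^[1+r]∙[x^c]^t)))
                  (∙-closed x^m∈H (⁻¹-closed (^-closed x^[1+c]∈H t)))

  trivialSubgroup : IsSubgroup (_≡ ε)
  trivialSubgroup = record
    { ε∈ = refl
    ; ∙-closed = λ x≡ε y≡ε → trans (cong₂ _∙_ x≡ε y≡ε) (identityˡ ε)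
    ; ⁻¹-closed = λ x≡ε → trans (cong _⁻¹ x≡ε) ε⁻¹≈ε }

  module Order (x : Fin n) = RelativeOrder (relativeOrder trivialSubgroup (_≟ ε) x)
    renaming (index to order; 0<index to 0<order; ^index∈ to ^order; index∣ to order∣)
  open Order using (order; 0<order; ^order; order∣)

  ^-≡-transfer : ∀ g y {a b} → g ^ a ≡ g ^ b → y ^ order g ≡ ε → y ^ a ≡ y ^ b
  ^-≡-transfer g y {a} {b} g^a≡g^b y^o≡ε with order∣ g (a + b * pred n)
    (trans (sym (^-quotient g a b)) (x≈y⇒x∙y⁻¹≈ε g^a≡g^b))
  ... | divides t a+b[n-1]≡t*o = x∙y⁻¹≈ε⇒x≈y _ _ (begin
    y ^ a ∙ (y ^ b) ⁻¹          ≡⟨ ^-quotient y a b ⟩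
    y ^ (a + b * pred n)        ≡⟨ cong (y ^_) a+b[n-1]≡t*o ⟩
    y ^ (t * order g)           ≡⟨ ^-*-comm y t (order g) ⟩
    (y ^ order g) ^ t           ≡⟨ cong (_^ t) y^o≡ε ⟩
    ε ^ t                       ≡⟨ ε^ t ⟩
    ε                           ∎)

  ⟨_⟩ : Fin n → Subset
  ⟨ g ⟩ z = ∃[ u ] z ≡ g ^ u

  ⟨⟩-isSubgroup : ∀ g → IsSubgroup ⟨ g ⟩
  ⟨⟩-isSubgroup g = record
    { ε∈ = 0 , refl
    ; ∙-closed = λ { (u , refl) (v , refl) → u + v , sym (^-+ g u v) }
    ; ⁻¹-closed = λ { (u , refl) → u * pred n , trans (⁻¹≡^pred[n] (g ^ u)) (sym (^-* g u (pred n))) } }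

  ⟨⟩? : ∀ g z → Dec (⟨ g ⟩ z)
  ⟨⟩? g z with any? (λ (i : Fin n) → z ≟ g ^ toℕ i)
  ... | yes (i , z≡g^i) = yes (toℕ i , z≡g^i)
  ... | no ∄i = no λ { (u , z≡g^u) → ∄i (fromℕ< (m%n<n u n) , (begin
    z                              ≡⟨ z≡g^u ⟩
    g ^ u                          ≡⟨ cong (g ^_) (m≡m%n+[m/n]*n u n) ⟩
    g ^ (u % n + (u / n) * n)      ≡⟨ ^-+*order g (u % n) (u / n) ⟩
    g ^ (u % n)                    ≡⟨ cong (g ^_) (toℕ-fromℕ< (m%n<n u n)) ⟨
    g ^ toℕ (fromℕ< (m%n<n u n))   ∎)) }
    where instance _ = nonZeroIndex ε

  opaque
    g : Fin n
    g = argmax order ε (allFin n)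

    order≤order[g] : ∀ x → order x ≤ order g
    order≤order[g] x = lookup (f[xs]≤f[argmax] {f = order} ε (allFin n)) (∈-allFin x)

  Independent : Fin n → Set
  Independent y = ∀ m → ⟨ g ⟩ (y ^ m) → y ^ m ≡ ε

  -- (g ∙ y) ^ m ≡ ε forces g ^ m ≡ y ^ m ≡ ε, so order (g ∙ y) ≡ order g by maximality.
  independent⇒^order[g] : ∀ y → Independent y → y ^ order g ≡ ε
  independent⇒^order[g] y y-indep = subst (λ k → y ^ k ≡ ε) m≡o y^m≡ε
    where
    m = order (g ∙ y)
    g^m∙y^m≡ε : g ^ m ∙ y ^ m ≡ ε
    g^m∙y^m≡ε = trans (sym (∙-^ g y m)) (^order (g ∙ y))
    y^m≡ε : y ^ m ≡ ε
    y^m≡ε = y-indep m (subst ⟨ g ⟩ (sym (inverseʳ-unique _ _ g^m∙y^m≡ε))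
                                  (IsSubgroup.⁻¹-closed (⟨⟩-isSubgroup g) (m , refl)))
    g^m≡ε : g ^ m ≡ ε
    g^m≡ε = trans (sym (identityʳ _)) (trans (cong (g ^ m ∙_) (sym y^m≡ε)) g^m∙y^m≡ε)
    m≡o : m ≡ order g
    m≡o = ℕₚ.≤-antisym (order≤order[g] (g ∙ y)) (∣⇒≤ {{ℕ.>-nonZero (0<order (g ∙ y))}} (order∣ g m g^m≡ε))

  ^c≡g^v⇒v≡0 : ∀ {y c v} → (∀ m → ⟨ g ⟩ (y ^ m) → c ∣ m) → y ^ c ≡ g ^ v → v < c → v ≡ 0
  ^c≡g^v⇒v≡0 {y} {c} {v} c∣ y^c≡g^v v<c = ℕₚ.n≤0⇒n≡0 (ℕₚ.≮⇒≥ 0≮v)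
    where
    0≮v : ¬ 0 < v
    0≮v 0<v with c∣ (order y) (0 , ^order y)
    ... | divides t o[y]≡t*c = ℕₚ.<-irrefl refl (ℕₚ.≤-<-trans o≤v*t (ℕₚ.<-≤-trans v*t<c*t c*t≤o))
      where
      t≢0 : NonZero t
      t≢0 = ℕₚ.m*n≢0⇒m≢0 t {{subst NonZero o[y]≡t*c (ℕ.>-nonZero (0<order y))}}
      g^[v*t]≡ε : g ^ (v * t) ≡ ε
      g^[v*t]≡ε = begin
        g ^ (v * t)      ≡⟨ ^-* g v t ⟩
        (g ^ v) ^ t      ≡⟨ cong (_^ t) y^c≡g^v ⟨
        (y ^ c) ^ t      ≡⟨ ^-*-comm y t c ⟨
        y ^ (t * c)      ≡⟨ cong (y ^_) o[y]≡t*c ⟨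
        y ^ order y      ≡⟨ ^order y ⟩
        ε                ∎
      o≤v*t : order g ≤ v * t
      o≤v*t = ∣⇒≤ {{ℕₚ.m*n≢0 v t {{ℕ.>-nonZero 0<v}} {{t≢0}}}} (order∣ g (v * t) g^[v*t]≡ε)
      v*t<c*t : v * t < c * t
      v*t<c*t = ℕₚ.*-monoˡ-< t {{t≢0}} v<c
      c*t≤o : c * t ≤ order g
      c*t≤o = subst (_≤ order g) (trans o[y]≡t*c (ℕₚ.*-comm t c)) (order≤order[g] y)

  decomposition : ∀ x → Σ (Fin n) λ y → Σ ℕ λ q → Independent y × x ≡ y ∙ g ^ q
  decomposition x = y , q , y-independent , sym (//-rightDividesˡ (g ^ q) x)
    where
    open RelativeOrder (relativeOrder (⟨⟩-isSubgroup g) (⟨⟩? g) x)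
      renaming (index to c; 0<index to 0<c; ^index∈ to x^c∈⟨g⟩; index∣ to c∣)
    open IsSubgroup (⟨⟩-isSubgroup g)
    instance _ = ℕ.>-nonZero 0<c
    u q v : ℕ
    u = proj₁ x^c∈⟨g⟩
    q = u / c
    v = u % c
    y : Fin n
    y = x ∙ (g ^ q) ⁻¹
    x^m∈⟨g⟩ : ∀ m → ⟨ g ⟩ (y ^ m) → ⟨ g ⟩ (x ^ m)
    x^m∈⟨g⟩ m y^m∈⟨g⟩ = subst ⟨ g ⟩ (trans (sym (∙-^ y (g ^ q) m)) (cong (_^ m) (//-rightDividesˡ (g ^ q) x)))
                               (∙-closed y^m∈⟨g⟩ (^-closed (q , refl) m))
    y^c≡g^v : y ^ c ≡ g ^ v
    y^c≡g^v = begin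
      (x ∙ (g ^ q) ⁻¹) ^ c                 ≡⟨ ∙-^ x ((g ^ q) ⁻¹) c ⟩
      x ^ c ∙ ((g ^ q) ⁻¹) ^ c             ≡⟨ cong₂ _∙_ (proj₂ x^c∈⟨g⟩) (⁻¹-^ (g ^ q) c) ⟩
      g ^ u ∙ ((g ^ q) ^ c) ⁻¹             ≡⟨ cong (λ k → g ^ k ∙ ((g ^ q) ^ c) ⁻¹) (m≡m%n+[m/n]*n u c) ⟩
      g ^ (v + q * c) ∙ ((g ^ q) ^ c) ⁻¹   ≡⟨ cong₂ (λ a b → a ∙ b ⁻¹) (^-+ g v (q * c)) (sym (^-* g q c)) ⟩
      g ^ v ∙ g ^ (q * c) ∙ (g ^ (q * c)) ⁻¹  ≡⟨ //-rightDividesʳ (g ^ (q * c)) (g ^ v) ⟩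
      g ^ v                                ∎
    y-exponents : ∀ m → ⟨ g ⟩ (y ^ m) → c ∣ m
    y-exponents m = c∣ m ∘ x^m∈⟨g⟩ m
    y^c≡ε : y ^ c ≡ ε
    y^c≡ε = trans y^c≡g^v (cong (g ^_) (^c≡g^v⇒v≡0 y-exponents y^c≡g^v (m%n<n u c)))
    y-independent : Independent y
    y-independent m y^m∈⟨g⟩ with y-exponents m y^m∈⟨g⟩
    ... | divides t refl = trans (^-*-comm y t c) (trans (cong (_^ t) y^c≡ε) (ε^ t))

  module Universal (σ : Fin n → Fin n) (σ-∙ : ∀ x y → σ (x ∙ y) ≡ σ x ∙ σ y)
                   (σ-power : ∀ x → ∃[ k ] σ x ≡ x ^ k) where

    open Homomorphism σ σ-∙

    k : ℕ
    k = proj₁ (σ-power g)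

    σ-independent : ∀ y → Independent y → σ y ≡ y ^ k
    σ-independent y y-independent = begin
      σ y       ≡⟨ proj₂ (σ-power y) ⟩
      y ^ kʸ    ≡⟨ y^kʸ≡y^j ⟩
      y ^ j     ≡⟨ ^-≡-transfer g y {j} {k} (sym g^k≡g^j) (independent⇒^order[g] y y-independent) ⟩
      y ^ k     ∎
      where
      j = proj₁ (σ-power (g ∙ y))
      kʸ = proj₁ (σ-power y)
      g^k∙y^kʸ≡g^j∙y^j : g ^ k ∙ y ^ kʸ ≡ g ^ j ∙ y ^ j
      g^k∙y^kʸ≡g^j∙y^j = begin
        g ^ k ∙ y ^ kʸ    ≡⟨ cong₂ _∙_ (proj₂ (σ-power g)) (proj₂ (σ-power y)) ⟨
        σ g ∙ σ y         ≡⟨ σ-∙ g y ⟨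
        σ (g ∙ y)         ≡⟨ proj₂ (σ-power (g ∙ y)) ⟩
        (g ∙ y) ^ j       ≡⟨ ∙-^ g y j ⟩
        g ^ j ∙ y ^ j     ∎
      y^kʸ≡y^j : y ^ kʸ ≡ y ^ j
      y^kʸ≡y^j = x∙y⁻¹≈ε⇒x≈y _ _ (trans (^-quotient y kʸ j) (y-independent (kʸ + j * pred n)
        (subst ⟨ g ⟩ (trans (sym (∙-swap g^k∙y^kʸ≡g^j∙y^j)) (^-quotient y kʸ j))
          (∙-closed (⁻¹-closed (k , refl)) (j , refl)))))
        where open IsSubgroup (⟨⟩-isSubgroup g)
      g^k≡g^j : g ^ k ≡ g ^ j
      g^k≡g^j = ∙-cancelʳ (y ^ j) (g ^ k) (g ^ j) (trans (cong (g ^ k ∙_) (sym y^kʸ≡y^j)) g^k∙y^kʸ≡g^j∙y^j)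

    σ-universal : ∀ x → σ x ≡ x ^ k
    σ-universal x with decomposition x
    ... | y , q , y-independent , x≡y∙g^q = begin
      σ x                   ≡⟨ cong σ x≡y∙g^q ⟩
      σ (y ∙ g ^ q)         ≡⟨ σ-∙ y (g ^ q) ⟩
      σ y ∙ σ (g ^ q)       ≡⟨ cong₂ _∙_ (σ-independent y y-independent) (σ-^ g q) ⟩
      y ^ k ∙ σ g ^ q       ≡⟨ cong (λ z → y ^ k ∙ z ^ q) (proj₂ (σ-power g)) ⟩
      y ^ k ∙ (g ^ k) ^ q   ≡⟨ cong (y ^ k ∙_) (^-comm g k q) ⟩
      y ^ k ∙ (g ^ q) ^ k   ≡⟨ ∙-^ y (g ^ q) k ⟨
      (y ∙ g ^ q) ^ k       ≡⟨ cong (_^ k) x≡y∙g^q ⟨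
      x ^ k                 ∎

  isPowerAutomorphism⇒universal : ∀ σ → IsPowerAutomorphism σ → Σ ℕ λ K → NonZero K × (∀ x → σ x ≡ x ^ K)
  isPowerAutomorphism⇒universal σ ((σ-∙ , _) , σ-power) =
    n + k , ℕ.>-nonZero (ℕₚ.<-≤-trans (ℕ.>-nonZero⁻¹ n {{nonZeroIndex ε}}) (ℕₚ.m≤m+n n k)) , λ x → begin
      σ x              ≡⟨ σ-universal x ⟩
      x ^ k            ≡⟨ identityˡ (x ^ k) ⟨
      ε ∙ x ^ k        ≡⟨ cong (_∙ x ^ k) (^-order x) ⟨
      x ^ n ∙ x ^ k    ≡⟨ ^-+ x n k ⟨
      x ^ (n + k)      ∎
    where open Universal σ σ-∙ σ-power using (k; σ-universal)

module Codes {n : ℕ} (G : FinAbGroup n) where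

  open import Data.Fin using (Fin)
  open import Data.Fin.Properties using (_≟_)
  open import Data.Nat as ℕ using (_*_; NonZero)
  open import Data.Nat.ListAction using (product)
  open import Data.Nat.Primality.Factorisation using (factorise; PrimeFactorisation)
  open import Data.Product using (Σ; proj₁; proj₂)
  open import Data.Sum using (_⊎_; map₁)
  open import Function using (id; _∘_)
  open import Relation.Nullary using (Dec)
  open import Relation.Nullary.Decidable using (map′; _×-dec_)
  open import Relation.Binary.PropositionalEquality
  open Counting

  open FinAbGroupProperties G
  open GroupSemiring G
  open PowerAutomorphisms G using (isPowerAutomorphism⇒universal)

  IsCodeAlong : (Fin n → Fin n) → Subset → Subset → Set
  IsCodeAlong σ B C = ∀ x → ExactlyOne (λ c → C c × B (σ c ∙ x ⁻¹))

  exactlyOne-resp : ∀ {P Q : Fin n → Set} → (∀ c → P c → Q c) → (∀ c → Q c → P c) → ExactlyOne P → ExactlyOne Q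
  exactlyOne-resp P⇒Q Q⇒P (c , Pc , unique) = c , P⇒Q c Pc , λ d Qd → unique d (Q⇒P d Qd)

  exactlyOne-dec : ∀ {P : Fin n → Set} → ExactlyOne P → ∀ a → Dec (P a)
  exactlyOne-dec (c , Pc , unique) a = map′ (λ a≡c → subst _ (sym a≡c) Pc) (unique a) (a ≟ c)

  code⇒decidable : ∀ {B C} → IsCodeAlong id B C → (∀ z → Dec (C z)) × (∀ z → Dec (B z))
  code⇒decidable {B} {C} code = C? , B?
    where
    -- a ∈ C iff a is the element of C covering a ∙ b₀⁻¹, and z ∈ B iff c₀ covers c₀ ∙ z⁻¹.
    c₀ = proj₁ (code ε)
    b₀ = c₀ ∙ ε ⁻¹
    C[c₀] = proj₁ (proj₁ (proj₂ (code ε)))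
    B[b₀] = proj₂ (proj₁ (proj₂ (code ε)))
    C? : ∀ a → Dec (C a)
    C? a = map′ proj₁ (λ C[a] → C[a] , subst B (sym (x∙[x∙w⁻¹]⁻¹≡w a _)) B[b₀])
                (exactlyOne-dec (code (a ∙ b₀ ⁻¹)) a)
    B? : ∀ z → Dec (B z)
    B? z = map′ (subst B (x∙[x∙w⁻¹]⁻¹≡w c₀ z) ∘ proj₂)
                (λ B[z] → C[c₀] , subst B (sym (x∙[x∙w⁻¹]⁻¹≡w c₀ z)) B[z])
                (exactlyOne-dec (code (c₀ ∙ z ⁻¹)) c₀)

  module _ {B C : Subset} (C? : ∀ z → Dec (C z)) (B? : ∀ z → Dec (B z)) where

    open Pushforward C?

    B̃ : ℕ[G]
    B̃ z = indicator (B? (z ⁻¹))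

    push-⋆-B̃ : ∀ σ x → (push σ ⋆ B̃) x ≡ count (λ c → C? c ×-dec B? (σ c ∙ x ⁻¹))
    push-⋆-B̃ σ x = trans (push-⋆ σ B̃ x) (∑-cong λ c → trans
      (cong (λ z → indicator (C? c) * indicator (B? z)) (⁻¹-anti-homo-// x (σ c)))
      (indicator-× (C? c) (B? (σ c ∙ x ⁻¹))))

    code⇒tiles : ∀ {σ} → IsCodeAlong σ B C → (push σ ⋆ B̃) ≗ ones
    code⇒tiles {σ} code x = trans (push-⋆-B̃ σ x) (exactlyOne⇒count≡1 _ (code x))

    tiles⇒code : ∀ {σ} → (push σ ⋆ B̃) ≗ ones → IsCodeAlong σ B C
    tiles⇒code {σ} tiles x = count≡1⇒exactlyOne _ (trans (sym (push-⋆-B̃ σ x)) (tiles x))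

  code⇒codeAlong-^ : ∀ {B C} m → .{{NonZero m}} → (∀ {x y} → x ^ m ≡ y ^ m → x ≡ y) →
           IsCodeAlong id B C → IsCodeAlong (_^ m) B C
  code⇒codeAlong-^ {B} {C} m ^m-injective code = tiles⇒code C? B? {_^ m} (λ x → begin
    (push (_^ m) ⋆ B̃ C? B?) x                          ≡⟨ ⋆-congˡ (B̃ C? B?) (push-cong (λ i → cong (i ^_) m≡∏ps)) x ⟩
    (push (λ i → i ^ product ps) ⋆ B̃ C? B?) x          ≡⟨ push-⋆-transfer-product C? ps ps-prime
                                                            (subst (λ k → ∀ {x y} → x ^ k ≡ y ^ k → x ≡ y) m≡∏ps ^m-injective)
                                                            id (B̃ C? B?) (code⇒tiles C? B? {id} code) x ⟩
    1                                                  ∎)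
    where
    open ≡-Reasoning
    C? : ∀ z → Dec (C z)
    C? = proj₁ (code⇒decidable {B} {C} code)
    B? : ∀ z → Dec (B z)
    B? = proj₂ (code⇒decidable {B} {C} code)
    open Pushforward C?
    open PrimeFactorisation (factorise m) renaming (factors to ps; factorsPrime to ps-prime; isFactorisation to m≡∏ps)

  codeAlong⇒code-image : ∀ {σ B C} → IsCodeAlong σ B C → IsCodeAlong id B (Image σ C)
  codeAlong⇒code-image {σ} code x with code x
  ... | c , (C[c] , B[σc/x]) , unique = σ c , ((c , C[c] , refl) , B[σc/x]) ,
        λ { d ((c′ , C[c′] , refl) , B[d/x]) → cong σ (unique c′ (C[c′] , B[d/x])) }

  universal-power-preserves-codes : ∀ σ m → .{{NonZero m}} → (∀ x → σ x ≡ x ^ m) → (∀ {x y} → σ x ≡ σ y → x ≡ y) →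
                                    PerfectCodePreserving σ × TotalPerfectCodePreserving σ
  universal-power-preserves-codes σ m σ≗^m σ-injective =
    (λ S _ C perfect → fromClosed {S} (preserves {Closed S} (toClosed {S} perfect))) , (λ S _ C → preserves {S})
    where
    ^m-injective : ∀ {x y} → x ^ m ≡ y ^ m → x ≡ y
    ^m-injective x^m≡y^m = σ-injective (trans (σ≗^m _) (trans x^m≡y^m (sym (σ≗^m _))))
    preserves : ∀ {B C} → IsCodeAlong id B C → IsCodeAlong id B (Image σ C)
    preserves {B} {C} code = codeAlong⇒code-image {σ} {B} {C} (λ x →
      exactlyOne-resp (λ c (C[c] , B[c^m/x]) → C[c] , subst (λ z → B (z ∙ x ⁻¹)) (sym (σ≗^m c)) B[c^m/x])
                      (λ c (C[c] , B[σc/x]) → C[c] , subst (λ z → B (z ∙ x ⁻¹)) (σ≗^m c) B[σc/x])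
                      (code⇒codeAlong-^ {B} {C} m ^m-injective code x))
    Closed : Subset → Subset
    Closed S z = z ≡ ε ⊎ S z
    toClosed : ∀ {S C} → IsPerfectCode S C → IsCodeAlong id (Closed S) C
    toClosed {S} perfect x = exactlyOne-resp (λ c (C[c] , c≡x⊎adj) → C[c] , map₁ x≈y⇒x∙y⁻¹≈ε c≡x⊎adj)
                                         (λ c (C[c] , c/x≡ε⊎adj) → C[c] , map₁ (x∙y⁻¹≈ε⇒x≈y _ _) c/x≡ε⊎adj) (perfect x)
    fromClosed : ∀ {S C} → IsCodeAlong id (Closed S) C → IsPerfectCode S C
    fromClosed {S} code x = exactlyOne-resp (λ c (C[c] , c/x≡ε⊎adj) → C[c] , map₁ (x∙y⁻¹≈ε⇒x≈y _ _) c/x≡ε⊎adj)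
                                        (λ c (C[c] , c≡x⊎adj) → C[c] , map₁ x≈y⇒x∙y⁻¹≈ε c≡x⊎adj) (code x)

  power-automorphism-preserves-codes : ∀ σ → IsPowerAutomorphism σ → PerfectCodePreserving σ × TotalPerfectCodePreserving σ
  power-automorphism-preserves-codes σ σ-powerAutomorphism@((_ , σ-injective , _) , _) =
    fromUniversal (isPowerAutomorphism⇒universal σ σ-powerAutomorphism)
    where
    fromUniversal : Σ ℕ (λ K → NonZero K × (∀ x → σ x ≡ x ^ K)) →
                    PerfectCodePreserving σ × TotalPerfectCodePreserving σ
    fromUniversal (K , K≢0 , σ≗^K) = universal-power-preserves-codes σ K {{K≢0}} σ≗^K σ-injective

  coprime-power-preserves-codes : ∀ m → 0 < m → Coprime m n →
    IsAutomorphism (_^ m) × PerfectCodePreserving (_^ m) × TotalPerfectCodePreserving (_^ m)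
  coprime-power-preserves-codes m 0<m m⊥n = ^m-automorphism ,
    universal-power-preserves-codes (_^ m) m {{ℕ.>-nonZero 0<m}} (λ _ → refl) (proj₁ (proj₂ ^m-automorphism))
    where ^m-automorphism = coprime⇒^-isAutomorphism m⊥n

corollary3p3 : ∀ (n : ℕ) (G : FinAbGroup n) →
    let open FinAbGroup G in
    (∀ σ → IsPowerAutomorphism σ →
       PerfectCodePreserving σ × TotalPerfectCodePreserving σ)
    × (∀ (m : ℕ) → 0 < m → Coprime m n →
       IsAutomorphism (λ g → g ^ m)
       × PerfectCodePreserving (λ g → g ^ m)
       × TotalPerfectCodePreserving (λ g → g ^ m))
corollary3p3 n G = power-automorphism-preserves-codes , coprime-power-preserves-codes
  where open Codes G
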